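{- The ordinary generating function $D(q,t,z)=\sum_{n\ge0}\sum_{p\in\mathcal{D}(n)} q^{\operatorname{area}(p)}t^{\operatorname{rk}(p)}z^n$ has the continued fraction expansion \[ D(q,t,z) =\cfrac{1}{1-\cfrac{z}{1-\cfrac{qtz}{1-\cfrac{q^2z}{1-\cfrac{q^3tz}{1-\cfrac{q^4z}{1-\cfrac{q^5tz}{\ddots}}}}}}},\] i.e. for $k\ge1$ the numerator at level $2k$ is $q^{2k-1}tz$ and the numerator at level $2k-1$ is $q^{2k-2}z$.
   Context: For $n\ge0$, $\mathcal{D}(n)$ is the set of Dyck paths of order $n$: lattice paths from $(0,0)$ to $(2n,0)$ with $n$ steps $(1,1)$ and $n$ steps $(1,-1)$ never going below the $x$-axis ($\mathcal{D}(0)$ contains only the empty path). $\operatorname{area}(p)$ is the number of points $(x,y)\in\mathbb{Z}^2$ with $x+y$ even and $y\ge0$ lying strictly below $p$. $\phi(p)$ is the set partition of $\{1,\dots,n\}$ in which $i,i'$ share a block iff for some $j$ both $(2i-1,2j-1)$ and $(2i'-1,2j-1)$ lie on $p$ and the part of $p$ between them never goes below $y=2j-1$; $\operatorname{rk}(p)=n-(\text{number of blocks of }\phi(p))$. The identity is one of formal power series in $z$ with coefficients in $\mathbb{Z}[q,t]$. -}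

module Defs where

open import Data.Bool using (Bool; true; false; _∧_; _∨_; not; if_then_else_)
open import Data.Nat as ℕ using (ℕ; zero; suc; _∸_; _⊔_; _⊓_)
open import Data.Integer as ℤ using (ℤ; +_; -[1+_])
open import Data.List using (List; []; _∷_; _++_; map)
open import Relation.Nullary.Decidable using (⌊_⌋)

countBelow : ℕ → (ℕ → Bool) → ℕ
countBelow zero    P = 0
countBelow (suc m) P = countBelow m P ℕ.+ (if P m then 1 else 0)

allBelow : ℕ → (ℕ → Bool) → Bool
allBelow zero    P = true
allBelow (suc m) P = allBelow m P ∧ P m

anyBelow : ℕ → (ℕ → Bool) → Bool
anyBelow zero    P = false
anyBelow (suc m) P = anyBelow m P ∨ P m

evenᵇ : ℕ → Bool
evenᵇ zero    = true
evenᵇ (suc n) = not (evenᵇ n)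

countList : {A : Set} → (A → Bool) → List A → ℕ
countList P []       = 0
countList P (x ∷ xs) = (if P x then 1 else 0) ℕ.+ countList P xs

-- Lattice paths: a word over Bool, true = up step (1,1), false = down step (1,-1)

allWords : ℕ → List (List Bool)
allWords zero    = [] ∷ []
allWords (suc m) = map (true ∷_) (allWords m) ++ map (false ∷_) (allWords m)

stepVal : Bool → ℤ
stepVal true  = + 1
stepVal false = -[1+ 0 ]

height : List Bool → ℕ → ℤ
height []      x       = + 0
height (b ∷ w) zero    = + 0
height (b ∷ w) (suc x) = stepVal b ℤ.+ height w x

numUp : List Bool → ℕ
numUp = countList (λ b → b)

numDown : List Bool → ℕ
numDown = countList not

isDyck : ℕ → List Bool → Bool
isDyck n w =
  ⌊ numUp w ℕ.≟ n ⌋ ∧ ⌊ numDown w ℕ.≟ n ⌋ ∧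
  allBelow (suc (2 ℕ.* n)) (λ x → ⌊ + 0 ℤ.≤? height w x ⌋)

sumBelow : ℕ → (ℕ → ℕ) → ℕ
sumBelow zero    f = 0
sumBelow (suc m) f = sumBelow m f ℕ.+ f m

-- area(p): number of lattice points (x,y), x+y even, y ≥ 0, strictly below p,
-- i.e. 0 ≤ x ≤ 2n and 0 ≤ y < height at x.  (y is bounded by 2n, harmless
-- since heights of a Dyck path of order n are ≤ n.)
area : ℕ → List Bool → ℕ
area n w =
  sumBelow (suc (2 ℕ.* n)) (λ x →
    countBelow (suc (2 ℕ.* n)) (λ y →
      evenᵇ (x ℕ.+ y) ∧ ⌊ + y ℤ.<? height w x ⌋))

onPath : List Bool → ℕ → ℤ → Bool
onPath w x y = ⌊ height w x ℤ.≟ y ⌋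

-- relation of φ(p) for i, i' ∈ {1..n}: for some j, both (2i-1,2j-1) and
-- (2i'-1,2j-1) lie on p and the part of p between them never goes below
-- y = 2j-1.  (j ranges over 0..n+1, which covers every possible j, since
-- 2j-1 must be a height in [0,n].)
sameBlock : ℕ → List Bool → ℕ → ℕ → Bool
sameBlock n w i i' =
  anyBelow (suc (suc n)) (λ j →
    let yj = + (2 ℕ.* j) ℤ.- + 1
        a  = 2 ℕ.* i ∸ 1
        b  = 2 ℕ.* i' ∸ 1
    in onPath w a yj ∧ onPath w b yj ∧
       allBelow (suc (2 ℕ.* n)) (λ x →
         not (⌊ (a ⊓ b) ℕ.≤? x ⌋ ∧ ⌊ x ℕ.≤? (a ⊔ b) ⌋)
         ∨ ⌊ yj ℤ.≤? height w x ⌋))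

-- number of blocks of φ(p): number of i ∈ {1..n} that are the least element
-- of their block (no i' < i in {1..n} related to i)
numBlocks : ℕ → List Bool → ℕ
numBlocks n w =
  countBelow n (λ k →
    not (anyBelow k (λ k' → sameBlock n w (suc k') (suc k))))

rk : ℕ → List Bool → ℕ
rk n w = n ∸ numBlocks n w

-- Formal power series in z with coefficients in ℤ[q,t], represented by the
-- coefficient function  (n , a , b) ↦ [z^n q^a t^b]

Series : Set
Series = ℕ → ℕ → ℕ → ℤ

sumUpTo : ℕ → (ℕ → ℤ) → ℤ
sumUpTo zero    f = f 0
sumUpTo (suc m) f = sumUpTo m f ℤ.+ f (suc m)

δ : ℕ → ℕ → ℤ
δ m k = if ⌊ m ℕ.≟ k ⌋ then + 1 else + 0

mono : ℕ → ℕ → ℕ → Series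
mono n a b n' a' b' = δ n n' ℤ.* δ a a' ℤ.* δ b b'

one : Series
one = mono 0 0 0

_⊛_ : Series → Series → Series
(A ⊛ B) n a b =
  sumUpTo n (λ n₁ → sumUpTo a (λ a₁ → sumUpTo b (λ b₁ →
    A n₁ a₁ b₁ ℤ.* B (n ∸ n₁) (a ∸ a₁) (b ∸ b₁))))

_^ˢ_ : Series → ℕ → Series
A ^ˢ zero  = one
A ^ˢ suc m = A ⊛ (A ^ˢ m)

-- 1/(1 − X) = Σ_m X^m, for X with zero constant term in z
-- (only X^0..X^n contribute to the coefficient of z^n)
inv1m : Series → Series
inv1m X n a b = sumUpTo n (λ m → (X ^ˢ m) n a b)

-- numerator at level k ≥ 1: level 2m−1 ↦ q^{2m−2} z, level 2m ↦ q^{2m−1} t z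
numerator : ℕ → Series
numerator k = mono 1 (k ∸ 1) (if evenᵇ k then 1 else 0)

-- truncated continued fraction starting at level k with d levels:
--   cf k 0 = 1,  cf k (d+1) = 1 / (1 − numerator k · cf (k+1) d)
cf : ℕ → ℕ → Series
cf k zero    = one
cf k (suc d) = inv1m (numerator k ⊛ cf (suc k) d)

Dgf : Series
Dgf n a b =
  + countList (λ w → isDyck n w ∧ ⌊ area n w ℕ.≟ a ⌋ ∧ ⌊ rk n w ℕ.≟ b ⌋)
              (allWords (2 ℕ.* n))

-- Flajolet's combinatorial reading of continued fractions.  Encode a Dyck path as a
-- word of up and down steps and give an up step leaving height h the weight
-- z q^h t^[h odd].  Then area(p) is the sum of the heights at which up steps start
-- (the column at abscissa x holds ⌊H(x)/2⌋ of the counted points, H(x) being the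
-- height there, and the two columns of an up step from h hold ⌊h/2⌋ + ⌈h/2⌉ = h),
-- and rk(p) is the number of up steps leaving an odd height: i is the least element
-- of its block of φ(p) exactly when p rises at abscissa 2i − 2, because after a
-- descent there the path last visited the odd level it reaches at an earlier odd
-- abscissa 2i′ − 1.  On the other side, the truncations E h of the continued
-- fraction starting at level h + 1 satisfy E h = 1 + w h · E (h + 1) · E h, so the
-- products P (h + 1) = E h ⋯ E 0 satisfy P (h + 1) = P h + w h · P (h + 2): the
-- first-step recursion of weighted paths from height h down to 0.  Hence
-- E 0 = P 1 counts the Dyck paths of height at most N, which for n < N are all Dyck
-- paths of semilength n.

module Submission where

open import Defs
open import Algebra.Bundles using (Semiring)
open import Data.Nat as ℕ using (ℕ; zero; suc; _∸_; _≤_; _<_; z≤n; s≤s; ⌊_/2⌋)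
open import Data.Nat.Properties as ℕ
  using (≤-refl; m≤n⇒m≤1+n; m≤n⇒m<n∨m≡n; m∸n≤m; n∸n≡0; ≤-pred; ≤∧≢⇒<; <-irrefl; ≤-<-trans)
open import Data.Sum using (inj₁; inj₂)
open import Data.Product using (_×_; _,_; ∃-syntax)
open import Data.List using (length)
open import Data.Empty using (⊥-elim)
open import Data.Bool using (Bool; true; false; T; if_then_else_; _∧_; _∨_; not)
open import Relation.Binary.PropositionalEquality as ≡ using (_≡_; _≢_)
open import Relation.Nullary using (Dec; yes; no; ¬_; contradiction)
open import Relation.Nullary.Decidable using (⌊_⌋; isYes≗does; dec-true; dec-false; does-⇔; toWitness)
open import Function.Bundles using (_⇔_; mk⇔)

⌊⌋-true : ∀ {a} {A : Set a} (a? : Dec A) → A → ⌊ a? ⌋ ≡ true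
⌊⌋-true a? a = ≡.trans (isYes≗does a?) (dec-true a? a)

⌊⌋-false : ∀ {a} {A : Set a} (a? : Dec A) → ¬ A → ⌊ a? ⌋ ≡ false
⌊⌋-false a? ¬a = ≡.trans (isYes≗does a?) (dec-false a? ¬a)

⌊⌋-true⁻ : ∀ {a} {A : Set a} (a? : Dec A) → ⌊ a? ⌋ ≡ true → A
⌊⌋-true⁻ a? ≡true = toWitness (≡.subst T (≡.sym ≡true) _)

⌊⌋-⇔ : ∀ {a b} {A : Set a} {B : Set b} → A ⇔ B → (a? : Dec A) (b? : Dec B) → ⌊ a? ⌋ ≡ ⌊ b? ⌋
⌊⌋-⇔ A⇔B a? b? = ≡.trans (isYes≗does a?) (≡.trans (does-⇔ A⇔B a? b?) (≡.sym (isYes≗does b?)))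

m∸n≡1+m∸[1+n] : ∀ {m n} → n < m → m ∸ n ≡ suc (m ∸ suc n)
m∸n≡1+m∸[1+n] {suc m} {zero}  _         = ≡.refl
m∸n≡1+m∸[1+n] {suc m} {suc n} (s≤s n<m) = m∸n≡1+m∸[1+n] n<m

∧-≡true : ∀ {x y} → x ∧ y ≡ true → x ≡ true × y ≡ true
∧-≡true {true} y≡true = ≡.refl , y≡true

module RangeSums {c ℓ} (R : Semiring c ℓ) where

  open Semiring R renaming (zero to *-zero)
  open import Algebra.Properties.CommutativeSemigroup +-commutativeSemigroup using (interchange)

  ∑≤ : ℕ → (ℕ → Carrier) → Carrier
  ∑≤ zero    f = f 0
  ∑≤ (suc n) f = ∑≤ n f + f (suc n)

  syntax ∑≤ n (λ i → e) = ∑[ i ≤ n ] e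

  ∑≤-cong : ∀ n {f g} → (∀ i → i ≤ n → f i ≈ g i) → ∑≤ n f ≈ ∑≤ n g
  ∑≤-cong zero    f≈g = f≈g 0 z≤n
  ∑≤-cong (suc n) f≈g =
    +-cong (∑≤-cong n (λ i i≤n → f≈g i (m≤n⇒m≤1+n i≤n))) (f≈g (suc n) ≤-refl)

  ∑≤-zero : ∀ n {f} → (∀ i → i ≤ n → f i ≈ 0#) → ∑≤ n f ≈ 0#
  ∑≤-zero zero    f≈0 = f≈0 0 z≤n
  ∑≤-zero (suc n) f≈0 = trans
    (+-cong (∑≤-zero n (λ i i≤n → f≈0 i (m≤n⇒m≤1+n i≤n))) (f≈0 (suc n) ≤-refl))
    (+-identityˡ 0#)

  ∑≤-+ : ∀ n f g → ∑[ i ≤ n ] (f i + g i) ≈ ∑≤ n f + ∑≤ n g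
  ∑≤-+ zero    f g = refl
  ∑≤-+ (suc n) f g = trans (+-congʳ (∑≤-+ n f g)) (interchange _ _ _ _)

  *-distribˡ-∑≤ : ∀ n x f → x * ∑≤ n f ≈ ∑[ i ≤ n ] (x * f i)
  *-distribˡ-∑≤ zero    x f = refl
  *-distribˡ-∑≤ (suc n) x f = trans (distribˡ x _ _) (+-congʳ (*-distribˡ-∑≤ n x f))

  ∑≤-suc : ∀ n f → ∑≤ (suc n) f ≈ f 0 + ∑[ i ≤ n ] f (suc i)
  ∑≤-suc zero    f = refl
  ∑≤-suc (suc n) f = trans (+-congʳ (∑≤-suc n f)) (+-assoc _ _ _)

  ∑≤-single : ∀ n j {f} → j ≤ n → (∀ i → i ≤ n → i ≢ j → f i ≈ 0#) → ∑≤ n f ≈ f j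
  ∑≤-single zero .zero z≤n _ = refl
  ∑≤-single (suc n) j j≤1+n f≈0 with j ℕ.≟ suc n
  ... | yes ≡.refl = trans
    (+-congʳ (∑≤-zero n (λ i i≤n → f≈0 i (m≤n⇒m≤1+n i≤n) λ { ≡.refl → <-irrefl ≡.refl (s≤s i≤n) })))
    (+-identityˡ _)
  ... | no j≢1+n = trans
    (+-cong (∑≤-single n j (≤-pred (≤∧≢⇒< j≤1+n j≢1+n)) (λ i i≤n → f≈0 i (m≤n⇒m≤1+n i≤n)))
            (f≈0 (suc n) ≤-refl (λ e → j≢1+n (≡.sym e))))
    (+-identityʳ _)

  ∑≤-extend : ∀ {n} m {f} → n ≤ m → (∀ i → n < i → f i ≈ 0#) → ∑≤ m f ≈ ∑≤ n f
  ∑≤-extend zero    z≤n  _   = refl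
  ∑≤-extend (suc m) n≤1+m f≈0 with m≤n⇒m<n∨m≡n n≤1+m
  ... | inj₂ ≡.refl      = refl
  ... | inj₁ (s≤s n≤m) = trans (+-cong (∑≤-extend m n≤m f≈0) (f≈0 (suc m) (s≤s n≤m))) (+-identityʳ _)

module PowerSeries {c ℓ} (R : Semiring c ℓ) where

  open Semiring R renaming (zero to *-zero)
  open RangeSums R
  open import Relation.Binary.Reasoning.Setoid setoid

  R⟦z⟧ : Set c
  R⟦z⟧ = ℕ → Carrier

  _≋_ : R⟦z⟧ → R⟦z⟧ → Set ℓ
  A ≋ B = ∀ n → A n ≈ B n

  _⊕_ : R⟦z⟧ → R⟦z⟧ → R⟦z⟧
  (A ⊕ B) n = A n + B n

  _⊗_ : R⟦z⟧ → R⟦z⟧ → R⟦z⟧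
  (A ⊗ B) n = ∑[ i ≤ n ] (A i * B (n ∸ i))

  monomial : ℕ → Carrier → R⟦z⟧
  monomial j x i = if ⌊ j ℕ.≟ i ⌋ then x else 0#

  monomial-≢ : ∀ {j i} x → i ≢ j → monomial j x i ≡ 0#
  monomial-≢ {j} {i} x i≢j with j ℕ.≟ i
  ... | yes j≡i = ⊥-elim (i≢j (≡.sym j≡i))
  ... | no  _   = ≡.refl

  monomial-≡ : ∀ j x → monomial j x j ≡ x
  monomial-≡ j x with j ℕ.≟ j
  ... | yes _   = ≡.refl
  ... | no  j≢j = ⊥-elim (j≢j ≡.refl)

  ⊗-cong≤ : ∀ n {A A′ B B′} → (∀ i → i ≤ n → A i ≈ A′ i) → (∀ i → i ≤ n → B i ≈ B′ i) →
            (A ⊗ B) n ≈ (A′ ⊗ B′) n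
  ⊗-cong≤ n A≈ B≈ = ∑≤-cong n (λ i i≤n → *-cong (A≈ i i≤n) (B≈ (n ∸ i) (m∸n≤m n i)))

  ⊗-suc : ∀ n A B → (A ⊗ B) (suc n) ≈ A 0 * B (suc n) + ((λ i → A (suc i)) ⊗ B) n
  ⊗-suc n A B = ∑≤-suc n _

  ⊗-*ˡ : ∀ n x A B → ((λ i → x * A i) ⊗ B) n ≈ x * (A ⊗ B) n
  ⊗-*ˡ n x A B = trans (∑≤-cong n (λ i _ → *-assoc _ _ _)) (sym (*-distribˡ-∑≤ n x _))

  ⊗-distribʳ : ∀ n A A′ B → ((A ⊕ A′) ⊗ B) n ≈ (A ⊗ B) n + (A′ ⊗ B) n
  ⊗-distribʳ n A A′ B = trans (∑≤-cong n (λ i _ → distribʳ _ _ _)) (∑≤-+ n _ _)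

  ⊗-distribˡ : ∀ n A B B′ → (A ⊗ (B ⊕ B′)) n ≈ (A ⊗ B) n + (A ⊗ B′) n
  ⊗-distribˡ n A B B′ = trans (∑≤-cong n (λ i _ → distribˡ _ _ _)) (∑≤-+ n _ _)

  ⊗-assoc : ∀ n A B C → ((A ⊗ B) ⊗ C) n ≈ (A ⊗ (B ⊗ C)) n
  ⊗-assoc zero    A B C = *-assoc _ _ _
  ⊗-assoc (suc n) A B C = begin
    ((A ⊗ B) ⊗ C) (suc n)
      ≈⟨ ⊗-suc n (A ⊗ B) C ⟩
    (A 0 * B 0) * C (suc n) + ((λ i → (A ⊗ B) (suc i)) ⊗ C) n
      ≈⟨ +-congˡ (⊗-cong≤ n {B = C} {B′ = C} (λ i _ → ⊗-suc i A B) (λ _ _ → refl)) ⟩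
    (A 0 * B 0) * C (suc n) + (((λ i → A 0 * B′ i) ⊕ (A′ ⊗ B)) ⊗ C) n
      ≈⟨ +-congˡ (⊗-distribʳ n _ _ C) ⟩
    (A 0 * B 0) * C (suc n) + (((λ i → A 0 * B′ i) ⊗ C) n + ((A′ ⊗ B) ⊗ C) n)
      ≈⟨ +-congˡ (+-cong (⊗-*ˡ n (A 0) B′ C) (⊗-assoc n A′ B C)) ⟩
    (A 0 * B 0) * C (suc n) + (A 0 * (B′ ⊗ C) n + (A′ ⊗ (B ⊗ C)) n)
      ≈⟨ sym (+-assoc _ _ _) ⟩
    ((A 0 * B 0) * C (suc n) + A 0 * (B′ ⊗ C) n) + (A′ ⊗ (B ⊗ C)) n
      ≈⟨ +-congʳ (trans (+-congʳ (*-assoc _ _ _)) (sym (distribˡ _ _ _))) ⟩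
    A 0 * (B 0 * C (suc n) + (B′ ⊗ C) n) + (A′ ⊗ (B ⊗ C)) n
      ≈⟨ +-congʳ (*-congˡ (sym (⊗-suc n B C))) ⟩
    A 0 * (B ⊗ C) (suc n) + (A′ ⊗ (B ⊗ C)) n
      ≈⟨ sym (⊗-suc n A (B ⊗ C)) ⟩
    (A ⊗ (B ⊗ C)) (suc n) ∎
    where
    A′ B′ : R⟦z⟧
    A′ i = A (suc i)
    B′ i = B (suc i)

  monomial-⊗ : ∀ {n j} x B → j ≤ n → (monomial j x ⊗ B) n ≈ x * B (n ∸ j)
  monomial-⊗ {n} {j} x B j≤n = trans
    (∑≤-single n j j≤n (λ i _ i≢j → trans (*-congʳ (reflexive (monomial-≢ x i≢j))) (zeroˡ _)))
    (*-congʳ (reflexive (monomial-≡ j x)))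

  monomial-⊗-< : ∀ {n j} x B → n < j → (monomial j x ⊗ B) n ≈ 0#
  monomial-⊗-< {n} x B n<j = ∑≤-zero n (λ i i≤n →
    trans (*-congʳ (reflexive (monomial-≢ x λ { ≡.refl → <-irrefl ≡.refl (≤-<-trans i≤n n<j) }))) (zeroˡ _))

  ⊗-monomialʳ : ∀ n A x → (A ⊗ monomial 0 x) n ≈ A n * x
  ⊗-monomialʳ n A x = trans
    (∑≤-single n n ≤-refl (λ i i≤n i≢n →
      trans (*-congˡ (reflexive (monomial-≢ x λ n∸i≡0 → i≢n (ℕ.≤-antisym i≤n (ℕ.m∸n≡0⇒m≤n n∸i≡0)))))
            (zeroʳ _)))
    (*-congˡ (reflexive (≡.cong (monomial 0 x) (n∸n≡0 n))))

  semiring : Semiring c ℓ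
  semiring = record
    { Carrier = R⟦z⟧
    ; _≈_ = _≋_
    ; _+_ = _⊕_
    ; _*_ = _⊗_
    ; 0# = λ _ → 0#
    ; 1# = monomial 0 1#
    ; isSemiring = record
      { isSemiringWithoutAnnihilatingZero = record
        { +-isCommutativeMonoid = record
          { isMonoid = record
            { isSemigroup = record
              { isMagma = record
                { isEquivalence = record
                  { refl = λ _ → refl ; sym = λ p n → sym (p n) ; trans = λ p q n → trans (p n) (q n) }
                ; ∙-cong = λ p q n → +-cong (p n) (q n) }
              ; assoc = λ A B C n → +-assoc _ _ _ }
            ; identity = (λ A n → +-identityˡ _) , (λ A n → +-identityʳ _) }
          ; comm = λ A B n → +-comm _ _ }
        ; *-cong = λ p q n → ⊗-cong≤ n (λ i _ → p i) (λ i _ → q i)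
        ; *-assoc = λ A B C n → ⊗-assoc n A B C
        ; *-identity = (λ B n → trans (monomial-⊗ 1# B z≤n) (*-identityˡ _))
                     , (λ A n → trans (⊗-monomialʳ n A 1#) (*-identityʳ _))
        ; distrib = (λ A B C n → ⊗-distribˡ n A B C) , (λ C A B n → ⊗-distribʳ n A B C) }
      ; zero = (λ A n → ∑≤-zero n (λ _ _ → zeroˡ _)) , (λ A n → ∑≤-zero n (λ _ _ → zeroʳ _)) } }

  ∑ˢ : ℕ → (ℕ → R⟦z⟧) → R⟦z⟧
  ∑ˢ = RangeSums.∑≤ semiring

  ∑ˢ-coeff : ∀ m F n → ∑ˢ m F n ≈ ∑[ i ≤ m ] F i n
  ∑ˢ-coeff zero    F n = refl
  ∑ˢ-coeff (suc m) F n = +-congʳ (∑ˢ-coeff m F n)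

  open import Algebra.Definitions.RawSemiring (Semiring.rawSemiring semiring) using (_^_)

  ^-vanishes : ∀ {X} → X 0 ≈ 0# → ∀ m {n} → n < m → (X ^ m) n ≈ 0#
  ^-vanishes {X} X₀≈0 (suc m) {n} (s≤s n≤m) = ∑≤-zero n vanishes
    where
    vanishes : ∀ i → i ≤ n → X i * (X ^ m) (n ∸ i) ≈ 0#
    vanishes zero    _         = trans (*-congʳ X₀≈0) (zeroˡ _)
    vanishes (suc i) (s≤s i≤n) = trans (*-congˡ (^-vanishes X₀≈0 m (≤-<-trans (m∸n≤m _ i) n≤m))) (zeroʳ _)

  geometric : R⟦z⟧ → R⟦z⟧
  geometric X n = ∑[ m ≤ n ] (X ^ m) n

  geometric-unfold : ∀ {X} → X 0 ≈ 0# → geometric X ≋ (monomial 0 1# ⊕ (X ⊗ geometric X))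
  geometric-unfold {X} X₀≈0 n = sym (begin
    monomial 0 1# n + (X ⊗ geometric X) n
      ≈⟨ +-congˡ (⊗-cong≤ n {B = geometric X} (λ _ _ → refl) (λ k k≤n → sym (partial-geometric n k≤n))) ⟩
    monomial 0 1# n + (X ⊗ ∑ˢ n (X ^_)) n
      ≈⟨ +-congˡ (RangeSums.*-distribˡ-∑≤ semiring n X (X ^_) n) ⟩
    monomial 0 1# n + ∑ˢ n (λ m → X ^ suc m) n
      ≈⟨ sym (RangeSums.∑≤-suc semiring n (X ^_) n) ⟩
    ∑ˢ (suc n) (X ^_) n
      ≈⟨ partial-geometric (suc n) (m≤n⇒m≤1+n ≤-refl) ⟩
    geometric X n ∎)
    where
    partial-geometric : ∀ M {k} → k ≤ M → ∑ˢ M (X ^_) k ≈ geometric X k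
    partial-geometric M {k} k≤M =
      trans (∑ˢ-coeff M (X ^_) k) (∑≤-extend M k≤M (λ m k<m → ^-vanishes X₀≈0 m k<m))

module _ {c ℓ} (R : Semiring c ℓ) where

  open Semiring R renaming (zero to *-zero)
  open import Relation.Binary.Reasoning.Setoid setoid

  productBelow : (ℕ → Carrier) → ℕ → Carrier
  productBelow E zero    = 1#
  productBelow E (suc h) = E h * productBelow E h

  productBelow-unfold : ∀ (w E : ℕ → Carrier) h → E h ≈ 1# + (w h * E (suc h)) * E h →
    productBelow E (suc h) ≈ productBelow E h + w h * productBelow E (suc (suc h))
  productBelow-unfold w E h E-unfold = begin
    E h * P h                                ≈⟨ *-congʳ E-unfold ⟩
    (1# + (w h * E (suc h)) * E h) * P h     ≈⟨ distribʳ (P h) 1# _ ⟩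
    1# * P h + ((w h * E (suc h)) * E h) * P h ≈⟨ +-cong (*-identityˡ (P h)) (*-assoc _ (E h) (P h)) ⟩
    P h + (w h * E (suc h)) * (E h * P h)    ≈⟨ +-congˡ (*-assoc (w h) (E (suc h)) _) ⟩
    P h + w h * (E (suc h) * (E h * P h))    ∎
    where
    P : ℕ → Carrier
    P = productBelow E

module Trivariate where

  open import Data.Integer using (ℤ; +_) renaming (_+_ to _+ℤ_)
  open import Data.Integer.Properties using (+-*-semiring; *-identityˡ)

  private
    module ℤ⟦t⟧     = PowerSeries +-*-semiring
    module ℤ⟦t,q⟧   = PowerSeries ℤ⟦t⟧.semiring
    module ℤ⟦t,q,z⟧ = PowerSeries ℤ⟦t,q⟧.semiring

  open ℤ⟦t,q,z⟧ public using (_≋_; _⊗_; _⊕_; semiring; geometric; geometric-unfold)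
  open import Algebra.Definitions.RawSemiring (Semiring.rawSemiring semiring) using (_^_)

  sumUpTo≡∑≤ : ∀ m f → sumUpTo m f ≡ RangeSums.∑≤ +-*-semiring m f
  sumUpTo≡∑≤ zero    f = ≡.refl
  sumUpTo≡∑≤ (suc m) f = ≡.cong (_+ℤ f (suc m)) (sumUpTo≡∑≤ m f)

  sumUpTo-cong : ∀ m {f g} → (∀ i → f i ≡ g i) → sumUpTo m f ≡ sumUpTo m g
  sumUpTo-cong m f≡g = ≡.trans (sumUpTo≡∑≤ m _)
    (≡.trans (RangeSums.∑≤-cong +-*-semiring m (λ i _ → f≡g i)) (≡.sym (sumUpTo≡∑≤ m _)))

  ∑≤-coeff : ∀ m (F : ℕ → ℕ → ℕ → ℤ) a b →
             RangeSums.∑≤ ℤ⟦t,q⟧.semiring m F a b ≡ sumUpTo m (λ i → F i a b)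
  ∑≤-coeff m F a b = ≡.trans (ℤ⟦t,q⟧.∑ˢ-coeff m F a b)
    (≡.trans (ℤ⟦t⟧.∑ˢ-coeff m (λ i → F i a) b) (≡.sym (sumUpTo≡∑≤ m _)))

  ⊛≡⊗ : ∀ A B n a b → (A ⊛ B) n a b ≡ (A ⊗ B) n a b
  ⊛≡⊗ A B n a b = ≡.sym (≡.trans (∑≤-coeff n _ a b) (sumUpTo-cong n λ i →
    ≡.trans (ℤ⟦t⟧.∑ˢ-coeff a _ b) (≡.trans (≡.sym (sumUpTo≡∑≤ a _)) (sumUpTo-cong a λ a₁ →
      ≡.sym (sumUpTo≡∑≤ b _)))))

  mono≋monomial : ∀ n a b → mono n a b ≋ ℤ⟦t,q,z⟧.monomial n (ℤ⟦t,q⟧.monomial a (ℤ⟦t⟧.monomial b (+ 1)))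
  mono≋monomial n a b n′ a′ b′ with n ℕ.≟ n′
  ... | no _  = ≡.refl
  ... | yes _ with a ℕ.≟ a′
  ...   | no _  = ≡.refl
  ...   | yes _ with b ℕ.≟ b′
  ...     | no _  = ≡.refl
  ...     | yes _ = ≡.refl

  one≋1 : one ≋ Semiring.1# semiring
  one≋1 = mono≋monomial 0 0 0

  ^ˢ≋^ : ∀ X m → (X ^ˢ m) ≋ (X ^ m)
  ^ˢ≋^ X zero    = one≋1
  ^ˢ≋^ X (suc m) n a b = ≡.trans (⊛≡⊗ X (X ^ˢ m) n a b)
    (Semiring.*-congˡ semiring {X} {X ^ˢ m} {X ^ m} (^ˢ≋^ X m) n a b)

  inv1m≋geometric : ∀ X → inv1m X ≋ geometric X
  inv1m≋geometric X n a b =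
    ≡.trans (sumUpTo-cong n (λ m → ^ˢ≋^ X m n a b)) (≡.sym (∑≤-coeff n _ a b))

  mono₁-⊗-zero : ∀ c e Y a b → (mono 1 c e ⊗ Y) 0 a b ≡ + 0
  mono₁-⊗-zero c e Y a b =
    ≡.trans (ℤ⟦t,q,z⟧.⊗-cong≤ 0 {B = Y} (λ i _ → mono≋monomial 1 c e i) (λ _ _ _ _ → ≡.refl) a b)
            (ℤ⟦t,q,z⟧.monomial-⊗-< {j = 1} zqᶜtᵉ Y (s≤s z≤n) a b)
    where zqᶜtᵉ = ℤ⟦t,q⟧.monomial c (ℤ⟦t⟧.monomial e (+ 1))

  mono₁-⊗-suc : ∀ c e Y u a b → (mono 1 c e ⊗ Y) (suc u) a b ≡
              (if ⌊ c ℕ.≤? a ⌋ ∧ ⌊ e ℕ.≤? b ⌋ then Y u (a ∸ c) (b ∸ e) else + 0)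
  mono₁-⊗-suc c e Y u a b =
    ≡.trans (ℤ⟦t,q,z⟧.⊗-cong≤ (suc u) {B = Y} (λ i _ → mono≋monomial 1 c e i) (λ _ _ _ _ → ≡.refl) a b)
    (≡.trans (ℤ⟦t,q,z⟧.monomial-⊗ {j = 1} qᶜtᵉ Y (s≤s z≤n) a b) coefficient)
    where
    qᶜtᵉ = ℤ⟦t,q⟧.monomial c (ℤ⟦t⟧.monomial e (+ 1))
    coefficient : ℤ⟦t,q⟧._⊗_ qᶜtᵉ (Y u) a b ≡
                  (if ⌊ c ℕ.≤? a ⌋ ∧ ⌊ e ℕ.≤? b ⌋ then Y u (a ∸ c) (b ∸ e) else + 0)
    coefficient with c ℕ.≤? a | e ℕ.≤? b
    ... | yes c≤a | yes e≤b = ≡.trans (ℤ⟦t,q⟧.monomial-⊗ (ℤ⟦t⟧.monomial e (+ 1)) (Y u) c≤a b)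
                             (≡.trans (ℤ⟦t⟧.monomial-⊗ (+ 1) (Y u (a ∸ c)) e≤b) (*-identityˡ _))
    ... | yes c≤a | no e≰b  = ≡.trans (ℤ⟦t,q⟧.monomial-⊗ (ℤ⟦t⟧.monomial e (+ 1)) (Y u) c≤a b)
                             (ℤ⟦t⟧.monomial-⊗-< (+ 1) (Y u (a ∸ c)) (ℕ.≰⇒> e≰b))
    ... | no c≰a  | _       = ℤ⟦t,q⟧.monomial-⊗-< (ℤ⟦t⟧.monomial e (+ 1)) (Y u) (ℕ.≰⇒> c≰a) b

  cf-suc : ∀ k d → cf k (suc d) ≋ (Semiring.1# semiring ⊕ ((numerator k ⊗ cf (suc k) d) ⊗ cf k (suc d)))
  cf-suc k d = begin
    inv1m X                                      ≈⟨ inv1m≋geometric X ⟩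
    geometric X                                  ≈⟨ geometric-unfold X₀≈0 ⟩
    1# + X * geometric X                         ≈⟨ +-congˡ {1#} (*-cong {X} X≋ (sym (inv1m≋geometric X))) ⟩
    1# + (numerator k * cf (suc k) d) * inv1m X  ∎
    where
    open Semiring semiring
    open import Relation.Binary.Reasoning.Setoid setoid
    X : Series
    X = numerator k ⊛ cf (suc k) d
    X≋ : X ≋ (numerator k ⊗ cf (suc k) d)
    X≋ = ⊛≡⊗ (numerator k) (cf (suc k) d)
    X₀≈0 : ∀ a b → X 0 a b ≡ + 0
    X₀≈0 a b = ≡.trans (X≋ 0 a b) (mono₁-⊗-zero (k ∸ 1) (if evenᵇ k then 1 else 0) (cf (suc k) d) a b)

module WeightedPaths where

  open import Data.List using (List; []; _∷_; _++_; map; length)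
  open import Data.Bool.Solver using (module ∨-∧-Solver)

  countList-++ : ∀ {A : Set} (P : A → Bool) xs ys → countList P (xs ++ ys) ≡ countList P xs ℕ.+ countList P ys
  countList-++ P []       ys = ≡.refl
  countList-++ P (x ∷ xs) ys =
    ≡.trans (≡.cong (_ ℕ.+_) (countList-++ P xs ys)) (≡.sym (ℕ.+-assoc (if P x then 1 else 0) _ _))

  countList-map : ∀ {A B : Set} (P : B → Bool) (f : A → B) xs →
                  countList P (map f xs) ≡ countList (λ x → P (f x)) xs
  countList-map P f []       = ≡.refl
  countList-map P f (x ∷ xs) = ≡.cong (_ ℕ.+_) (countList-map P f xs)

  countList-false : ∀ {A : Set} (xs : List A) → countList (λ _ → false) xs ≡ 0
  countList-false []       = ≡.refl
  countList-false (x ∷ xs) = countList-false xs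

  countList-guard : ∀ {A : Set} g (P : A → Bool) xs →
                    countList (λ x → g ∧ P x) xs ≡ (if g then countList P xs else 0)
  countList-guard true  P xs = ≡.refl
  countList-guard false P xs = countList-false xs

  countList-allWords-suc : ∀ (P : List Bool → Bool) m →
    countList P (allWords (suc m)) ≡
    countList (λ w → P (true ∷ w)) (allWords m) ℕ.+ countList (λ w → P (false ∷ w)) (allWords m)
  countList-allWords-suc P m = ≡.trans (countList-++ P (map (true ∷_) (allWords m)) _)
    (≡.cong₂ ℕ._+_ (countList-map P (true ∷_) (allWords m)) (countList-map P (false ∷_) (allWords m)))

  countList-allWords-cong : ∀ {P Q : List Bool → Bool} m → (∀ w → length w ≡ m → P w ≡ Q w) →
    countList P (allWords m) ≡ countList Q (allWords m)
  countList-allWords-cong zero    P≡Q = ≡.cong (λ b → (if b then 1 else 0) ℕ.+ 0) (P≡Q [] ≡.refl)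
  countList-allWords-cong (suc m) P≡Q = ≡.trans (countList-allWords-suc _ m) (≡.trans
    (≡.cong₂ ℕ._+_ (countList-allWords-cong m (λ w e → P≡Q (true ∷ w) (≡.cong suc e)))
                   (countList-allWords-cong m (λ w e → P≡Q (false ∷ w) (≡.cong suc e))))
    (≡.sym (countList-allWords-suc _ m)))

  returnsToZero : ℕ → List Bool → Bool
  returnsToZero h       []          = h ℕ.≡ᵇ 0
  returnsToZero h       (true ∷ w)  = returnsToZero (suc h) w
  returnsToZero zero    (false ∷ w) = false
  returnsToZero (suc h) (false ∷ w) = returnsToZero h w

  staysBelow : ℕ → ℕ → List Bool → Bool
  staysBelow d h []          = true
  staysBelow d h (true ∷ w)  = ⌊ h ℕ.<? d ⌋ ∧ staysBelow d (suc h) w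
  staysBelow d h (false ∷ w) = staysBelow d (ℕ.pred h) w

  upArea : ℕ → List Bool → ℕ
  upArea h []          = 0
  upArea h (true ∷ w)  = h ℕ.+ upArea (suc h) w
  upArea h (false ∷ w) = upArea (ℕ.pred h) w

  tExp : ℕ → ℕ
  tExp h = if evenᵇ (suc h) then 1 else 0

  oddUps : ℕ → List Bool → ℕ
  oddUps h []          = 0
  oddUps h (true ∷ w)  = tExp h ℕ.+ oddUps (suc h) w
  oddUps h (false ∷ w) = oddUps (ℕ.pred h) w

  isWeightedPath : (d h a b : ℕ) → List Bool → Bool
  isWeightedPath d h a b w =
    returnsToZero h w ∧ staysBelow d h w ∧ ⌊ upArea h w ℕ.≟ a ⌋ ∧ ⌊ oddUps h w ℕ.≟ b ⌋

  pathCount : (d h m a b : ℕ) → ℕ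
  pathCount d h m a b = countList (isWeightedPath d h a b) (allWords m)

  pathsUp : (d h m a b : ℕ) → ℕ
  pathsUp d h m a b =
    if ⌊ h ℕ.<? d ⌋ ∧ ⌊ h ℕ.≤? a ⌋ ∧ ⌊ tExp h ℕ.≤? b ⌋
    then pathCount d (suc h) m (a ∸ h) (b ∸ tExp h)
    else 0

  pathsDown : (d h m a b : ℕ) → ℕ
  pathsDown d zero    m a b = 0
  pathsDown d (suc h) m a b = pathCount d h m a b

  ⌊+≟⌋ : ∀ h x a → ⌊ h ℕ.+ x ℕ.≟ a ⌋ ≡ ⌊ h ℕ.≤? a ⌋ ∧ ⌊ x ℕ.≟ a ∸ h ⌋
  ⌊+≟⌋ h x a with h ℕ.≤? a
  ... | yes h≤a = ⌊⌋-⇔ (mk⇔ (λ e → ≡.trans (≡.sym (ℕ.m+n∸m≡n h x)) (≡.cong (_∸ h) e))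
                             (λ e → ≡.trans (≡.cong (h ℕ.+_) e) (ℕ.m+[n∸m]≡n h≤a))) _ _
  ... | no  h≰a = ⌊⌋-false _ (λ e → h≰a (≡.subst (h ≤_) e (ℕ.m≤m+n h x)))

  pathCount-suc : ∀ d h m a b → pathCount d h (suc m) a b ≡ pathsUp d h m a b ℕ.+ pathsDown d h m a b
  pathCount-suc d h m a b = ≡.trans (countList-allWords-suc _ m) (≡.cong₂ ℕ._+_ up (down h))
    where
    open ∨-∧-Solver using (solve; _:=_; _:*_)
    guards : ∀ r g₁ s g₂ x g₃ y →
      r ∧ (g₁ ∧ s) ∧ (g₂ ∧ x) ∧ (g₃ ∧ y) ≡ (g₁ ∧ g₂ ∧ g₃) ∧ r ∧ s ∧ x ∧ y
    guards = solve 7 (λ r g₁ s g₂ x g₃ y →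
      r :* ((g₁ :* s) :* ((g₂ :* x) :* (g₃ :* y))) := (g₁ :* (g₂ :* g₃)) :* (r :* (s :* (x :* y)))) ≡.refl
    up : countList (λ w → isWeightedPath d h a b (true ∷ w)) (allWords m) ≡ pathsUp d h m a b
    up = ≡.trans (countList-allWords-cong m (λ w _ → ≡.trans (shift-targets w)
                   (guards (returnsToZero (suc h) w) ⌊ h ℕ.<? d ⌋ (staysBelow d (suc h) w)
                           ⌊ h ℕ.≤? a ⌋ ⌊ upArea (suc h) w ℕ.≟ a ∸ h ⌋
                           ⌊ tExp h ℕ.≤? b ⌋ ⌊ oddUps (suc h) w ℕ.≟ b ∸ tExp h ⌋)))
                 (countList-guard _ _ (allWords m))
      where
      shift-targets : ∀ w → isWeightedPath d h a b (true ∷ w) ≡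
        returnsToZero (suc h) w ∧ (⌊ h ℕ.<? d ⌋ ∧ staysBelow d (suc h) w) ∧
        (⌊ h ℕ.≤? a ⌋ ∧ ⌊ upArea (suc h) w ℕ.≟ a ∸ h ⌋) ∧
        (⌊ tExp h ℕ.≤? b ⌋ ∧ ⌊ oddUps (suc h) w ℕ.≟ b ∸ tExp h ⌋)
      shift-targets w =
        ≡.cong₂ (λ x y → returnsToZero (suc h) w ∧ (⌊ h ℕ.<? d ⌋ ∧ staysBelow d (suc h) w) ∧ x ∧ y)
                (⌊+≟⌋ h _ a) (⌊+≟⌋ (tExp h) _ b)
    down : ∀ h → countList (λ w → isWeightedPath d h a b (false ∷ w)) (allWords m) ≡ pathsDown d h m a b
    down zero    = countList-false (allWords m)
    down (suc h) = ≡.refl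

  returnsToZero-short : ∀ h w → length w < h → returnsToZero h w ≡ false
  returnsToZero-short (suc h) []          _         = ≡.refl
  returnsToZero-short h       (true ∷ w)  len       =
    returnsToZero-short (suc h) w (ℕ.<-trans (ℕ.n<1+n _) (ℕ.m<n⇒m<1+n len))
  returnsToZero-short (suc h) (false ∷ w) (s≤s len) = returnsToZero-short h w len

  pathCount-short : ∀ d h m a b → m < h → pathCount d h m a b ≡ 0
  pathCount-short d h m a b m<h = ≡.trans (countList-allWords-cong m too-short) (countList-false (allWords m))
    where
    too-short : ∀ w → length w ≡ m → isWeightedPath d h a b w ≡ false
    too-short w len rewrite returnsToZero-short h w (≡.subst (_< h) (≡.sym len) m<h) = ≡.refl

module PathTransfer (N : ℕ) where

  open import Data.Integer using (ℤ; +_) renaming (_+_ to _+ℤ_)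
  import Data.Integer.Properties as ℤ
  open import Data.Bool.Properties using (if-float; if-eta)
  open Trivariate
  open WeightedPaths
  open Semiring semiring using (1#; *-congʳ; *-identityˡ)

  E : ℕ → Series
  E h = cf (suc h) (N ∸ h)

  P : ℕ → Series
  P = productBelow semiring E

  E-unfold : ∀ h → h < N → E h ≋ (1# ⊕ ((numerator (suc h) ⊗ E (suc h)) ⊗ E h))
  E-unfold h h<N = ≡.subst (λ d → cf (suc h) d ≋ (1# ⊕ ((numerator (suc h) ⊗ E (suc h)) ⊗ cf (suc h) d)))
                           (≡.sym (m∸n≡1+m∸[1+n] h<N)) (cf-suc (suc h) (N ∸ suc h))

  E-top : E N ≋ 1#
  E-top = ≡.subst (λ d → cf (suc N) d ≋ 1#) (≡.sym (n∸n≡0 N)) one≋1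

  upTerm : ℕ → ℕ → ℕ → ℕ → ℤ
  upTerm h u a b = if ⌊ h ℕ.<? N ⌋ then (numerator (suc h) ⊗ P (suc (suc h))) u a b else + 0

  upTerm-zero : ∀ h a b → upTerm h 0 a b ≡ + 0
  upTerm-zero h a b with h ℕ.<? N
  ... | yes _ = mono₁-⊗-zero h (tExp h) (P (suc (suc h))) a b
  ... | no  _ = ≡.refl

  P-suc : ∀ h → h ≤ N → ∀ u a b → P (suc h) u a b ≡ P h u a b +ℤ upTerm h u a b
  P-suc h h≤N u a b = step (h ℕ.<? N)
    where
    step : (h<N? : Dec (h < N)) →
      P (suc h) u a b ≡ P h u a b +ℤ (if ⌊ h<N? ⌋ then (numerator (suc h) ⊗ P (suc (suc h))) u a b else + 0)
    step (yes h<N) = productBelow-unfold semiring (λ h → numerator (suc h)) E h (E-unfold h h<N) u a b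
    step (no  h≮N) =
      ≡.trans (≡.trans (*-congʳ {P h} Eh≋1 u a b) (*-identityˡ (P h) u a b)) (≡.sym (ℤ.+-identityʳ _))
      where
      Eh≋1 : E h ≋ 1#
      Eh≋1 = ≡.subst (λ k → E k ≋ 1#) (ℕ.≤-antisym (ℕ.≮⇒≥ h≮N) h≤N) E-top

  -- A path from height h down to 0 with u up steps has length 2u + h; u is the exponent of z.
  pathCount≡P : ∀ m h u a b → m ≡ u ℕ.+ u ℕ.+ h → h ≤ N → + pathCount N h m a b ≡ P (suc h) u a b
  pathsDown≡P : ∀ m h u a b → suc m ≡ u ℕ.+ u ℕ.+ h → h ≤ N → + pathsDown N h m a b ≡ P h u a b
  pathsUp≡upTerm : ∀ m h u a b → suc m ≡ u ℕ.+ u ℕ.+ h → + pathsUp N h m a b ≡ upTerm h u a b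

  pathCount≡P zero zero zero a b ≡.refl 0≤N = begin
    + pathCount N 0 0 a b        ≡⟨ empty-path a b ⟩
    P 0 0 a b                    ≡⟨ ≡.sym (ℤ.+-identityʳ _) ⟩
    P 0 0 a b +ℤ + 0             ≡⟨ ≡.cong (P 0 0 a b +ℤ_) (≡.sym (upTerm-zero 0 a b)) ⟩
    P 0 0 a b +ℤ upTerm 0 0 a b  ≡⟨ ≡.sym (P-suc 0 0≤N 0 a b) ⟩
    P 1 0 a b                    ∎
    where
    open ≡.≡-Reasoning
    empty-path : ∀ a b → + pathCount N 0 0 a b ≡ P 0 0 a b
    empty-path zero    zero    = ≡.refl
    empty-path zero    (suc b) = ≡.refl
    empty-path (suc a) zero    = ≡.refl
    empty-path (suc a) (suc b) = ≡.refl
  pathCount≡P (suc m) h u a b eq h≤N = begin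
    + pathCount N h (suc m) a b
      ≡⟨ ≡.cong +_ (pathCount-suc N h m a b) ⟩
    + pathsUp N h m a b +ℤ + pathsDown N h m a b
      ≡⟨ ℤ.+-comm (+ pathsUp N h m a b) (+ pathsDown N h m a b) ⟩
    + pathsDown N h m a b +ℤ + pathsUp N h m a b
      ≡⟨ ≡.cong₂ _+ℤ_ (pathsDown≡P m h u a b eq h≤N) (pathsUp≡upTerm m h u a b eq) ⟩
    P h u a b +ℤ upTerm h u a b
      ≡⟨ ≡.sym (P-suc h h≤N u a b) ⟩
    P (suc h) u a b ∎
    where open ≡.≡-Reasoning

  pathsDown≡P m zero    (suc u) a b eq _   = ≡.refl
  pathsDown≡P m (suc h) u       a b eq h≤N =
    pathCount≡P m h u a b (ℕ.suc-injective (≡.trans eq (ℕ.+-suc (u ℕ.+ u) h))) (ℕ.≤-trans (ℕ.n≤1+n h) h≤N)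

  pathsUp≡upTerm m h u a b eq = guarded (h ℕ.<? N)
    where
    g : Bool
    g = ⌊ h ℕ.≤? a ⌋ ∧ ⌊ tExp h ℕ.≤? b ⌋
    ups : ∀ u → suc m ≡ u ℕ.+ u ℕ.+ h → h < N →
      + (if g then pathCount N (suc h) m (a ∸ h) (b ∸ tExp h) else 0) ≡ (numerator (suc h) ⊗ P (suc (suc h))) u a b
    ups zero     eq h<N = ≡.trans
      (≡.cong (λ n → + (if g then n else 0)) (pathCount-short N (suc h) m (a ∸ h) (b ∸ tExp h) m<1+h))
      (≡.trans (≡.cong +_ (if-eta g)) (≡.sym (mono₁-⊗-zero h (tExp h) (P (suc (suc h))) a b)))
      where
      m<1+h : m < suc h
      m<1+h = ℕ.m<n⇒m<1+n (≡.subst (m <_) eq (ℕ.n<1+n m))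
    ups (suc u′) eq h<N = ≡.trans (if-float +_ g)
      (≡.trans (≡.cong (λ z → if g then z else + 0)
                       (pathCount≡P m (suc h) u′ (a ∸ h) (b ∸ tExp h) (ℕ.suc-injective (≡.trans eq suc-length)) h<N))
               (≡.sym (mono₁-⊗-suc h (tExp h) (P (suc (suc h))) u′ a b)))
      where
      suc-length : suc u′ ℕ.+ suc u′ ℕ.+ h ≡ suc (u′ ℕ.+ u′ ℕ.+ suc h)
      suc-length = ≡.trans (≡.cong (λ x → suc x ℕ.+ h) (ℕ.+-suc u′ u′))
                           (≡.cong suc (≡.sym (ℕ.+-suc (u′ ℕ.+ u′) h)))
    guarded : (h<N? : Dec (h < N)) →
      + (if ⌊ h<N? ⌋ ∧ g then pathCount N (suc h) m (a ∸ h) (b ∸ tExp h) else 0) ≡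
      (if ⌊ h<N? ⌋ then (numerator (suc h) ⊗ P (suc (suc h))) u a b else + 0)
    guarded (yes h<N) = ups u eq h<N
    guarded (no  _)   = ≡.refl

module BoundedQuantifiers where

  open import Data.Bool.Properties using (∧-zeroʳ; ∨-zeroʳ)

  allBelow-sound : ∀ m P → allBelow m P ≡ true → ∀ x → x < m → P x ≡ true
  allBelow-sound (suc m) P all x x<1+m with ∧-≡true {allBelow m P} all | m≤n⇒m<n∨m≡n (≤-pred x<1+m)
  ... | below , _  | inj₁ x<m    = allBelow-sound m P below x x<m
  ... | _    , top | inj₂ ≡.refl = top

  allBelow-complete : ∀ m P → (∀ x → x < m → P x ≡ true) → allBelow m P ≡ true
  allBelow-complete zero    P all = ≡.refl
  allBelow-complete (suc m) P all =
    ≡.cong₂ _∧_ (allBelow-complete m P (λ x x<m → all x (ℕ.m<n⇒m<1+n x<m))) (all m ≤-refl)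

  allBelow-refute : ∀ m P x → x < m → P x ≡ false → allBelow m P ≡ false
  allBelow-refute (suc m) P x x<1+m Px with m≤n⇒m<n∨m≡n (≤-pred x<1+m)
  ... | inj₁ x<m    = ≡.cong (_∧ P m) (allBelow-refute m P x x<m Px)
  ... | inj₂ ≡.refl = ≡.trans (≡.cong (allBelow m P ∧_) Px) (∧-zeroʳ _)

  anyBelow-complete : ∀ m P x → x < m → P x ≡ true → anyBelow m P ≡ true
  anyBelow-complete (suc m) P x x<1+m Px with m≤n⇒m<n∨m≡n (≤-pred x<1+m)
  ... | inj₁ x<m    = ≡.cong (_∨ P m) (anyBelow-complete m P x x<m Px)
  ... | inj₂ ≡.refl = ≡.trans (≡.cong (anyBelow m P ∨_) Px) (∨-zeroʳ _)

  anyBelow-refute : ∀ m P → (∀ x → x < m → P x ≡ false) → anyBelow m P ≡ false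
  anyBelow-refute zero    P none = ≡.refl
  anyBelow-refute (suc m) P none =
    ≡.cong₂ _∨_ (anyBelow-refute m P (λ x x<m → none x (ℕ.m<n⇒m<1+n x<m))) (none m ≤-refl)

  countBelow-cong : ∀ m {P Q} → (∀ x → x < m → P x ≡ Q x) → countBelow m P ≡ countBelow m Q
  countBelow-cong zero    P≡Q = ≡.refl
  countBelow-cong (suc m) P≡Q = ≡.cong₂ (λ c b → c ℕ.+ (if b then 1 else 0))
    (countBelow-cong m (λ x x<m → P≡Q x (ℕ.m<n⇒m<1+n x<m))) (P≡Q m ≤-refl)

  countBelow-extend : ∀ {k} m {P} → k ≤ m → (∀ x → k ≤ x → P x ≡ false) → countBelow m P ≡ countBelow k P
  countBelow-extend zero    z≤n _ = ≡.refl
  countBelow-extend (suc m) {P} k≤1+m P≡false with m≤n⇒m<n∨m≡n k≤1+m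
  ... | inj₂ ≡.refl    = ≡.refl
  ... | inj₁ (s≤s k≤m) = ≡.trans
    (≡.cong₂ (λ c b → c ℕ.+ (if b then 1 else 0)) (countBelow-extend m k≤m P≡false) (P≡false m k≤m))
    (ℕ.+-identityʳ _)

  countBelow-suc : ∀ m P → countBelow (suc m) P ≡ (if P 0 then 1 else 0) ℕ.+ countBelow m (λ x → P (suc x))
  countBelow-suc zero    P = ℕ.+-comm 0 _
  countBelow-suc (suc m) P = ≡.trans (≡.cong (ℕ._+ (if P (suc m) then 1 else 0)) (countBelow-suc m P))
                                     (ℕ.+-assoc (if P 0 then 1 else 0) _ _)

  sumBelow-cong : ∀ m {f g} → (∀ x → x < m → f x ≡ g x) → sumBelow m f ≡ sumBelow m g
  sumBelow-cong zero    f≡g = ≡.refl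
  sumBelow-cong (suc m) f≡g =
    ≡.cong₂ ℕ._+_ (sumBelow-cong m (λ x x<m → f≡g x (ℕ.m<n⇒m<1+n x<m))) (f≡g m ≤-refl)

  sumBelow-suc : ∀ m f → sumBelow (suc m) f ≡ f 0 ℕ.+ sumBelow m (λ x → f (suc x))
  sumBelow-suc zero    f = ℕ.+-comm 0 _
  sumBelow-suc (suc m) f = ≡.trans (≡.cong (ℕ._+ f (suc m)) (sumBelow-suc m f)) (ℕ.+-assoc (f 0) _ _)

module Parity where

  open import Data.Bool.Properties using (not-involutive)

  evenᵇ-suc-suc : ∀ m → evenᵇ (suc (suc m)) ≡ evenᵇ m
  evenᵇ-suc-suc m = not-involutive (evenᵇ m)

  2[1+k]∸1≡1+2k : ∀ k → 2 ℕ.* suc k ∸ 1 ≡ suc (2 ℕ.* k)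
  2[1+k]∸1≡1+2k k = ≡.cong (_∸ 1) (ℕ.*-suc 2 k)

  evenᵇ-2* : ∀ k → evenᵇ (2 ℕ.* k) ≡ true
  evenᵇ-2* zero    = ≡.refl
  evenᵇ-2* (suc k) = ≡.trans (≡.cong evenᵇ (ℕ.*-suc 2 k)) (≡.trans (evenᵇ-suc-suc (2 ℕ.* k)) (evenᵇ-2* k))

  odd⇒1+2* : ∀ x → evenᵇ x ≡ false → ∃[ k ] x ≡ suc (2 ℕ.* k)
  odd⇒1+2* (suc zero)    _   = 0 , ≡.refl
  odd⇒1+2* (suc (suc x)) odd with odd⇒1+2* x (≡.trans (≡.sym (evenᵇ-suc-suc x)) odd)
  ... | k , ≡.refl = suc k , ≡.cong suc (≡.sym (ℕ.*-suc 2 k))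

last-visit : ∀ (f : ℕ → ℕ) c → (∀ x → f (suc x) ≤ suc (f x)) → f 0 ≤ c → ∀ p → c < f p →
             ∃[ x₀ ] x₀ < p × f x₀ ≡ c × (∀ x → x₀ ≤ x → x ≤ p → c ≤ f x)
last-visit f c slow f₀≤c zero    c<f₀ = contradiction f₀≤c (ℕ.<⇒≱ c<f₀)
last-visit f c slow f₀≤c (suc p) c<fp′ with f p ℕ.≤? c
... | yes fp≤c = p , ≤-refl , fp≡c , above
  where
  fp≡c : f p ≡ c
  fp≡c = ℕ.≤-antisym fp≤c (≤-pred (ℕ.<-≤-trans c<fp′ (slow p)))
  above : ∀ x → p ≤ x → x ≤ suc p → c ≤ f x
  above x p≤x x≤p′ with m≤n⇒m<n∨m≡n x≤p′
  ... | inj₂ ≡.refl    = ℕ.<⇒≤ c<fp′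
  ... | inj₁ (s≤s x≤p) = ≡.subst (λ x → c ≤ f x) (ℕ.≤-antisym p≤x x≤p) (ℕ.≤-reflexive (≡.sym fp≡c))
... | no  fp≰c with last-visit f c slow f₀≤c p (ℕ.≰⇒> fp≰c)
...   | x₀ , x₀<p , fx₀≡c , above = x₀ , ℕ.m<n⇒m<1+n x₀<p , fx₀≡c , above′
  where
  above′ : ∀ x → x₀ ≤ x → x ≤ suc p → c ≤ f x
  above′ x x₀≤x x≤p′ with m≤n⇒m<n∨m≡n x≤p′
  ... | inj₂ ≡.refl    = ℕ.<⇒≤ c<fp′
  ... | inj₁ (s≤s x≤p) = above x x₀≤x x≤p

module DyckHeights where

  open import Data.List using (List; []; _∷_; length)
  open import Data.Integer as ℤ using (+_; -[1+_]; +≤+)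
  import Data.Integer.Properties as ℤ
  open import Data.Bool.Properties using (⇔→≡)
  open WeightedPaths
  open BoundedQuantifiers
  open Parity

  heightFrom : ℕ → List Bool → ℕ → ℕ
  heightFrom h w           zero    = h
  heightFrom h []          (suc x) = h
  heightFrom h (true ∷ w)  (suc x) = heightFrom (suc h) w x
  heightFrom h (false ∷ w) (suc x) = heightFrom (ℕ.pred h) w x

  +1+ : ∀ h y → + h ℤ.+ (+ 1 ℤ.+ y) ≡ + suc h ℤ.+ y
  +1+ h y = ≡.trans (≡.sym (ℤ.+-assoc (+ h) (+ 1) y)) (≡.cong (λ k → + k ℤ.+ y) (ℕ.+-comm h 1))

  -1+ : ∀ h y → + suc h ℤ.+ (-[1+ 0 ] ℤ.+ y) ≡ + h ℤ.+ y
  -1+ h y = ≡.sym (ℤ.+-assoc (+ suc h) -[1+ 0 ] y)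

  +-height : ∀ h w → returnsToZero h w ≡ true → ∀ x → + h ℤ.+ height w x ≡ + heightFrom h w x
  +-height h       []          _ zero    = ≡.cong +_ (ℕ.+-identityʳ h)
  +-height h       []          _ (suc x) = ≡.cong +_ (ℕ.+-identityʳ h)
  +-height h       (b ∷ w)     _ zero    = ≡.cong +_ (ℕ.+-identityʳ h)
  +-height h       (true ∷ w)  r (suc x) = ≡.trans (+1+ h (height w x)) (+-height (suc h) w r x)
  +-height (suc h) (false ∷ w) r (suc x) = ≡.trans (-1+ h (height w x)) (+-height h w r x)

  height≡heightFrom : ∀ w → returnsToZero 0 w ≡ true → ∀ x → height w x ≡ + heightFrom 0 w x
  height≡heightFrom w r x = ≡.trans (≡.sym (ℤ.+-identityˡ (height w x))) (+-height 0 w r x)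

  numUp+numDown : ∀ w → length w ≡ numUp w ℕ.+ numDown w
  numUp+numDown []          = ≡.refl
  numUp+numDown (true ∷ w)  = ≡.cong suc (numUp+numDown w)
  numUp+numDown (false ∷ w) = ≡.trans (≡.cong suc (numUp+numDown w)) (≡.sym (ℕ.+-suc (numUp w) (numDown w)))

  returnsToZero-balanced : ∀ h w → returnsToZero h w ≡ true → h ℕ.+ numUp w ≡ numDown w
  returnsToZero-balanced zero    []          _ = ≡.refl
  returnsToZero-balanced h       (true ∷ w)  r = ≡.trans (ℕ.+-suc h (numUp w)) (returnsToZero-balanced (suc h) w r)
  returnsToZero-balanced (suc h) (false ∷ w) r = ≡.cong suc (returnsToZero-balanced h w r)

  numUp≡half : ∀ n w → returnsToZero 0 w ≡ true → length w ≡ 2 ℕ.* n → numUp w ≡ n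
  numUp≡half n w r len = begin
    numUp w                      ≡⟨ ℕ.n≡⌊n+n/2⌋ (numUp w) ⟩
    ⌊ numUp w ℕ.+ numUp w /2⌋    ≡⟨ ≡.cong (λ k → ⌊ numUp w ℕ.+ k /2⌋) (returnsToZero-balanced 0 w r) ⟩
    ⌊ numUp w ℕ.+ numDown w /2⌋  ≡⟨ ≡.cong ⌊_/2⌋ (≡.trans (≡.sym (numUp+numDown w)) len) ⟩
    ⌊ 2 ℕ.* n /2⌋                ≡⟨ ≡.cong ⌊_/2⌋ (≡.cong (n ℕ.+_) (ℕ.+-identityʳ n)) ⟩
    ⌊ n ℕ.+ n /2⌋                ≡⟨ ≡.sym (ℕ.n≡⌊n+n/2⌋ n) ⟩
    n                            ∎
    where open ≡.≡-Reasoning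

  returnsToZero-complete : ∀ h w → (∀ x → x ≤ length w → + 0 ℤ.≤ + h ℤ.+ height w x) →
                           h ℕ.+ numUp w ≡ numDown w → returnsToZero h w ≡ true
  returnsToZero-complete zero    []          _      _   = ≡.refl
  returnsToZero-complete h       (true ∷ w)  nonneg bal = returnsToZero-complete (suc h) w
    (λ x x≤ → ≡.subst (+ 0 ℤ.≤_) (+1+ h (height w x)) (nonneg (suc x) (s≤s x≤)))
    (≡.trans (≡.sym (ℕ.+-suc h (numUp w))) bal)
  returnsToZero-complete zero    (false ∷ w) nonneg _   =
    contradiction (≡.subst (λ y → + 0 ℤ.≤ + 0 ℤ.+ (-[1+ 0 ] ℤ.+ y)) (height-0 w) (nonneg 1 (s≤s z≤n))) λ ()
    where
    height-0 : ∀ w → height w 0 ≡ + 0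
    height-0 []      = ≡.refl
    height-0 (_ ∷ _) = ≡.refl
  returnsToZero-complete (suc h) (false ∷ w) nonneg bal = returnsToZero-complete h w
    (λ x x≤ → ≡.subst (+ 0 ℤ.≤_) (-1+ h (height w x)) (nonneg (suc x) (s≤s x≤)))
    (ℕ.suc-injective bal)

  isDyck≡returnsToZero : ∀ n w → length w ≡ 2 ℕ.* n → isDyck n w ≡ returnsToZero 0 w
  isDyck≡returnsToZero n w len = ⇔→≡ {z = true} (mk⇔ sound complete)
    where
    sound : isDyck n w ≡ true → returnsToZero 0 w ≡ true
    sound dyck with ∧-≡true {⌊ numUp w ℕ.≟ n ⌋} dyck
    ... | numUp≡n , rest with ∧-≡true {⌊ numDown w ℕ.≟ n ⌋} rest
    ... | numDown≡n , nonneg = returnsToZero-complete 0 w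
      (λ x x≤ → ≡.subst (+ 0 ℤ.≤_) (≡.sym (ℤ.+-identityˡ (height w x)))
        (⌊⌋-true⁻ (+ 0 ℤ.≤? height w x) (allBelow-sound _ _ nonneg x (s≤s (≡.subst (x ≤_) len x≤)))))
      (≡.trans (⌊⌋-true⁻ (numUp w ℕ.≟ n) numUp≡n) (≡.sym (⌊⌋-true⁻ (numDown w ℕ.≟ n) numDown≡n)))
    complete : returnsToZero 0 w ≡ true → isDyck n w ≡ true
    complete r = ≡.cong₂ _∧_ (⌊⌋-true (numUp w ℕ.≟ n) (numUp≡half n w r len))
      (≡.cong₂ _∧_ (⌊⌋-true (numDown w ℕ.≟ n)
                            (≡.trans (≡.sym (returnsToZero-balanced 0 w r)) (numUp≡half n w r len)))
        (allBelow-complete _ _ (λ x _ → ⌊⌋-true (+ 0 ℤ.≤? height w x)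
          (≡.subst (+ 0 ℤ.≤_) (≡.sym (height≡heightFrom w r x)) (+≤+ z≤n)))))

  staysBelow-complete : ∀ d h w → returnsToZero h w ≡ true → h ℕ.+ numUp w ≤ d → staysBelow d h w ≡ true
  staysBelow-complete d h       []          _ _  = ≡.refl
  staysBelow-complete d h       (true ∷ w)  r le = ≡.cong₂ _∧_
    (⌊⌋-true (h ℕ.<? d) (ℕ.<-≤-trans (ℕ.m<m+n h (s≤s z≤n)) le))
    (staysBelow-complete d (suc h) w r (≡.subst (_≤ d) (ℕ.+-suc h (numUp w)) le))
  staysBelow-complete d (suc h) (false ∷ w) r le = staysBelow-complete d h w r (ℕ.≤-trans (ℕ.n≤1+n _) le)

  heightFrom-parity : ∀ h w x → returnsToZero h w ≡ true → x ≤ length w →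
                      evenᵇ (heightFrom h w x) ≡ evenᵇ (h ℕ.+ x)
  heightFrom-parity h       w           zero    _ _         = ≡.cong evenᵇ (≡.sym (ℕ.+-identityʳ h))
  heightFrom-parity h       (true ∷ w)  (suc x) r (s≤s x≤) =
    ≡.trans (heightFrom-parity (suc h) w x r x≤) (≡.cong evenᵇ (≡.sym (ℕ.+-suc h x)))
  heightFrom-parity (suc h) (false ∷ w) (suc x) r (s≤s x≤) =
    ≡.trans (heightFrom-parity h w x r x≤)
            (≡.sym (≡.trans (≡.cong (λ k → evenᵇ (suc k)) (ℕ.+-suc h x)) (evenᵇ-suc-suc (h ℕ.+ x))))

  heightFrom-≤ : ∀ h w x → heightFrom h w x ≤ h ℕ.+ x
  heightFrom-≤ h w           zero    = ℕ.m≤m+n h 0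
  heightFrom-≤ h []          (suc x) = ℕ.m≤m+n h (suc x)
  heightFrom-≤ h (true ∷ w)  (suc x) =
    ≡.subst (heightFrom (suc h) w x ≤_) (≡.sym (ℕ.+-suc h x)) (heightFrom-≤ (suc h) w x)
  heightFrom-≤ h (false ∷ w) (suc x) =
    ℕ.≤-trans (heightFrom-≤ (ℕ.pred h) w x) (ℕ.+-mono-≤ ℕ.pred[n]≤n (ℕ.n≤1+n x))

  stepAt : List Bool → ℕ → Bool
  stepAt []      x       = false
  stepAt (b ∷ w) zero    = b
  stepAt (b ∷ w) (suc x) = stepAt w x

  heightFrom-up : ∀ h w x → stepAt w x ≡ true → heightFrom h w (suc x) ≡ suc (heightFrom h w x)
  heightFrom-up h (true ∷ w)  zero    _  = ≡.refl
  heightFrom-up h (true ∷ w)  (suc x) up = heightFrom-up (suc h) w x up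
  heightFrom-up h (false ∷ w) (suc x) up = heightFrom-up (ℕ.pred h) w x up

  heightFrom-down : ∀ h w x → returnsToZero h w ≡ true → stepAt w x ≡ false → x < length w →
                    heightFrom h w x ≡ suc (heightFrom h w (suc x))
  heightFrom-down (suc h) (false ∷ w) zero    _ _    _         = ≡.refl
  heightFrom-down h       (true ∷ w)  (suc x) r down (s≤s x<) = heightFrom-down (suc h) w x r down x<
  heightFrom-down (suc h) (false ∷ w) (suc x) r down (s≤s x<) = heightFrom-down h w x r down x<

  heightFrom-suc-≤ : ∀ h w x → heightFrom h w (suc x) ≤ suc (heightFrom h w x)
  heightFrom-suc-≤ h []          zero    = ℕ.n≤1+n h
  heightFrom-suc-≤ h []          (suc x) = ℕ.n≤1+n h
  heightFrom-suc-≤ h (true ∷ w)  zero    = ≤-refl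
  heightFrom-suc-≤ h (false ∷ w) zero    = ℕ.≤-trans ℕ.pred[n]≤n (ℕ.n≤1+n h)
  heightFrom-suc-≤ h (true ∷ w)  (suc x) = heightFrom-suc-≤ (suc h) w x
  heightFrom-suc-≤ h (false ∷ w) (suc x) = heightFrom-suc-≤ (ℕ.pred h) w x

module DyckArea where

  open import Data.List using (List; []; _∷_; length)
  open import Data.Integer as ℤ using (+_)
  import Data.Integer.Properties as ℤ
  open import Data.Bool.Properties using (∧-zeroʳ; ∧-identityʳ)
  open import Data.Nat.Tactic.RingSolver using (solve-∀)
  open import Function using (_∘_)
  open WeightedPaths
  open BoundedQuantifiers
  open Parity
  open DyckHeights

  countBelow-sameParity : ∀ k x → evenᵇ x ≡ evenᵇ k → countBelow k (λ y → evenᵇ (x ℕ.+ y)) ≡ ⌊ k /2⌋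
  countBelow-sameParity zero          x _ = ≡.refl
  countBelow-sameParity (suc zero)    x x-odd rewrite ℕ.+-identityʳ x | x-odd = ≡.refl
  countBelow-sameParity (suc (suc k)) x parity rewrite ℕ.+-suc x k =
    ≡.trans (≡.cong (λ c → (c ℕ.+ (if evenᵇ (x ℕ.+ k) then 1 else 0)) ℕ.+
                           (if not (evenᵇ (x ℕ.+ k)) then 1 else 0))
                    (countBelow-sameParity k x (≡.trans parity (evenᵇ-suc-suc k))))
            (one-of-two ⌊ k /2⌋ (evenᵇ (x ℕ.+ k)))
    where
    one-of-two : ∀ c e → (c ℕ.+ (if e then 1 else 0)) ℕ.+ (if not e then 1 else 0) ≡ suc c
    one-of-two c true  = ≡.trans (ℕ.+-identityʳ (c ℕ.+ 1)) (ℕ.+-comm c 1)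
    one-of-two c false = ≡.trans (≡.cong (ℕ._+ 1) (ℕ.+-identityʳ c)) (ℕ.+-comm c 1)

  points-below : ∀ M x k → k ≤ M → evenᵇ x ≡ evenᵇ k →
                 countBelow M (λ y → evenᵇ (x ℕ.+ y) ∧ ⌊ + y ℤ.<? + k ⌋) ≡ ⌊ k /2⌋
  points-below M x k k≤M parity = begin
    countBelow M (λ y → evenᵇ (x ℕ.+ y) ∧ ⌊ + y ℤ.<? + k ⌋)
      ≡⟨ countBelow-extend M k≤M (λ y k≤y →
           ≡.trans (≡.cong (evenᵇ (x ℕ.+ y) ∧_) (⌊⌋-false _ (ℕ.≤⇒≯ k≤y ∘ ℤ.drop‿+<+))) (∧-zeroʳ _)) ⟩
    countBelow k (λ y → evenᵇ (x ℕ.+ y) ∧ ⌊ + y ℤ.<? + k ⌋)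
      ≡⟨ countBelow-cong k (λ y y<k →
           ≡.trans (≡.cong (evenᵇ (x ℕ.+ y) ∧_) (⌊⌋-true _ (ℤ.+<+ y<k))) (∧-identityʳ _)) ⟩
    countBelow k (λ y → evenᵇ (x ℕ.+ y))
      ≡⟨ countBelow-sameParity k x parity ⟩
    ⌊ k /2⌋ ∎
    where open ≡.≡-Reasoning

  ∑⌊heightFrom/2⌋ : ∀ h w → returnsToZero h w ≡ true →
    sumBelow (suc (length w)) (λ x → ⌊ heightFrom h w x /2⌋) ≡ upArea h w ℕ.+ sumBelow (suc h) ⌊_/2⌋
  ∑⌊heightFrom/2⌋ zero    []          _ = ≡.refl
  ∑⌊heightFrom/2⌋ h       (true ∷ w)  r = begin
    sumBelow (suc (length (true ∷ w))) (λ x → ⌊ heightFrom h (true ∷ w) x /2⌋)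
      ≡⟨ sumBelow-suc (suc (length w)) _ ⟩
    ⌊ h /2⌋ ℕ.+ sumBelow (suc (length w)) (λ x → ⌊ heightFrom (suc h) w x /2⌋)
      ≡⟨ ≡.cong (⌊ h /2⌋ ℕ.+_) (∑⌊heightFrom/2⌋ (suc h) w r) ⟩
    ⌊ h /2⌋ ℕ.+ (upArea (suc h) w ℕ.+ (sumBelow (suc h) ⌊_/2⌋ ℕ.+ ⌊ suc h /2⌋))
      ≡⟨ rearrange ⌊ h /2⌋ (upArea (suc h) w) (sumBelow (suc h) ⌊_/2⌋) ⌊ suc h /2⌋ ⟩
    (⌊ h /2⌋ ℕ.+ ⌊ suc h /2⌋ ℕ.+ upArea (suc h) w) ℕ.+ sumBelow (suc h) ⌊_/2⌋
      ≡⟨ ≡.cong (λ k → (k ℕ.+ upArea (suc h) w) ℕ.+ sumBelow (suc h) ⌊_/2⌋) (ℕ.⌊n/2⌋+⌈n/2⌉≡n h) ⟩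
    (h ℕ.+ upArea (suc h) w) ℕ.+ sumBelow (suc h) ⌊_/2⌋ ∎
    where
    open ≡.≡-Reasoning
    rearrange : ∀ p A G q → p ℕ.+ (A ℕ.+ (G ℕ.+ q)) ≡ ((p ℕ.+ q) ℕ.+ A) ℕ.+ G
    rearrange = solve-∀
  ∑⌊heightFrom/2⌋ (suc h) (false ∷ w) r = ≡.trans (sumBelow-suc (suc (length w)) _)
    (≡.trans (≡.cong (⌊ suc h /2⌋ ℕ.+_) (∑⌊heightFrom/2⌋ h w r))
             (rearrange ⌊ suc h /2⌋ (upArea h w) (sumBelow (suc h) ⌊_/2⌋)))
    where
    rearrange : ∀ p A G → p ℕ.+ (A ℕ.+ G) ≡ A ℕ.+ (G ℕ.+ p)
    rearrange = solve-∀

  area≡upArea : ∀ n w → returnsToZero 0 w ≡ true → length w ≡ 2 ℕ.* n → area n w ≡ upArea 0 w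
  area≡upArea n w r len = begin
    area n w
      ≡⟨ sumBelow-cong (suc (2 ℕ.* n)) column ⟩
    sumBelow (suc (2 ℕ.* n)) (λ x → ⌊ heightFrom 0 w x /2⌋)
      ≡⟨ ≡.cong (λ L → sumBelow (suc L) (λ x → ⌊ heightFrom 0 w x /2⌋)) (≡.sym len) ⟩
    sumBelow (suc (length w)) (λ x → ⌊ heightFrom 0 w x /2⌋)
      ≡⟨ ∑⌊heightFrom/2⌋ 0 w r ⟩
    upArea 0 w ℕ.+ 0
      ≡⟨ ℕ.+-identityʳ _ ⟩
    upArea 0 w ∎
    where
    open ≡.≡-Reasoning
    column : ∀ x → x < suc (2 ℕ.* n) →
      countBelow (suc (2 ℕ.* n)) (λ y → evenᵇ (x ℕ.+ y) ∧ ⌊ + y ℤ.<? height w x ⌋) ≡ ⌊ heightFrom 0 w x /2⌋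
    column x x≤2n rewrite height≡heightFrom w r x =
      points-below (suc (2 ℕ.* n)) x (heightFrom 0 w x) (ℕ.≤-trans (heightFrom-≤ 0 w x) (ℕ.<⇒≤ x≤2n))
        (≡.sym (heightFrom-parity 0 w x r (≡.subst (x ≤_) (≡.sym len) (≤-pred x≤2n))))

module DyckRank where

  open import Data.List using (List; []; _∷_; length)
  open import Data.Integer as ℤ using (ℤ; +_)
  import Data.Integer.Properties as ℤ
  open import Data.Bool.Properties using (∧-zeroʳ)
  open WeightedPaths
  open BoundedQuantifiers
  open Parity
  open DyckHeights

  linked : ℕ → List Bool → ℕ → ℕ → ℤ → Bool
  linked n w a b y = onPath w a y ∧ onPath w b y ∧
    allBelow (suc (2 ℕ.* n)) (λ x →
      not (⌊ a ℕ.⊓ b ℕ.≤? x ⌋ ∧ ⌊ x ℕ.≤? a ℕ.⊔ b ⌋) ∨ ⌊ y ℤ.≤? height w x ⌋)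

  linked-refute : ∀ {n w a b y} x → x < suc (2 ℕ.* n) → a ≤ x → x ≤ b →
                  (height w b ≡ y → height w x ℤ.< y) → linked n w a b y ≡ false
  linked-refute {n} {w} {a} {b} {y} x x<1+2n a≤x x≤b dips with onPath w b y in on-b
  ... | false = ∧-zeroʳ (onPath w a y)
  ... | true  = ≡.trans (≡.cong (onPath w a y ∧_) (allBelow-refute _ _ x x<1+2n outside)) (∧-zeroʳ _)
    where
    outside : not (⌊ a ℕ.⊓ b ℕ.≤? x ⌋ ∧ ⌊ x ℕ.≤? a ℕ.⊔ b ⌋) ∨ ⌊ y ℤ.≤? height w x ⌋ ≡ false
    outside = ≡.cong₂ (λ p q → not p ∨ q)
      (≡.cong₂ _∧_ (⌊⌋-true (a ℕ.⊓ b ℕ.≤? x) (ℕ.≤-trans (ℕ.m⊓n≤m a b) a≤x))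
                   (⌊⌋-true (x ℕ.≤? a ℕ.⊔ b) (ℕ.≤-trans x≤b (ℕ.m≤n⊔m a b))))
      (⌊⌋-false (y ℤ.≤? height w x) (ℤ.<⇒≱ (dips (⌊⌋-true⁻ (height w b ℤ.≟ y) on-b))))

  linked-establish : ∀ {n w a b y} → a ≤ b → height w a ≡ y → height w b ≡ y →
                     (∀ x → a ≤ x → x ≤ b → y ℤ.≤ height w x) → linked n w a b y ≡ true
  linked-establish {n} {w} {a} {b} {y} a≤b ha hb above =
    ≡.cong₂ _∧_ (⌊⌋-true (height w a ℤ.≟ y) ha)
      (≡.cong₂ _∧_ (⌊⌋-true (height w b ℤ.≟ y) hb) (allBelow-complete _ _ (λ x _ → inside x)))
    where
    inside : ∀ x → not (⌊ a ℕ.⊓ b ℕ.≤? x ⌋ ∧ ⌊ x ℕ.≤? a ℕ.⊔ b ⌋) ∨ ⌊ y ℤ.≤? height w x ⌋ ≡ true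
    inside x with a ℕ.⊓ b ℕ.≤? x | x ℕ.≤? a ℕ.⊔ b
    ... | no  _   | _       = ≡.refl
    ... | yes _   | no  _   = ≡.refl
    ... | yes a≤x | yes x≤b =
      ⌊⌋-true _ (above x (≡.subst (_≤ x) (ℕ.m≤n⇒m⊓n≡m a≤b) a≤x) (≡.subst (x ≤_) (ℕ.m≤n⇒m⊔n≡n a≤b) x≤b))

  blockLeader-up : ∀ n w k → returnsToZero 0 w ≡ true → k < n → stepAt w (2 ℕ.* k) ≡ true →
                   anyBelow k (λ k′ → sameBlock n w (suc k′) (suc k)) ≡ false
  blockLeader-up n w k r k<n up = anyBelow-refute k _ λ k′ k′<k →
    anyBelow-refute (suc (suc n))
                    (λ j → linked n w (2 ℕ.* suc k′ ∸ 1) (2 ℕ.* suc k ∸ 1) (+ (2 ℕ.* j) ℤ.- + 1)) λ j _ →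
    linked-refute {n} {w} (2 ℕ.* k) (s≤s (ℕ.*-monoʳ-≤ 2 (ℕ.<⇒≤ k<n)))
      (≡.subst (_≤ 2 ℕ.* k) (≡.sym (2[1+k]∸1≡1+2k k′))
        (ℕ.≤-trans (ℕ.n≤1+n _) (≡.subst (_≤ 2 ℕ.* k) (ℕ.*-suc 2 k′) (ℕ.*-monoʳ-≤ 2 k′<k))))
      (≡.subst (2 ℕ.* k ≤_) (≡.sym (2[1+k]∸1≡1+2k k)) (ℕ.n≤1+n _))
      (λ on-b → ≡.subst (height w (2 ℕ.* k) ℤ.<_) on-b (begin-strict
        height w (2 ℕ.* k)                        ≡⟨ height≡heightFrom w r _ ⟩
        + heightFrom 0 w (2 ℕ.* k)                <⟨ ℤ.+<+ (ℕ.n<1+n _) ⟩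
        + suc (heightFrom 0 w (2 ℕ.* k))          ≡⟨ ≡.cong +_ (≡.sym (heightFrom-up 0 w _ up)) ⟩
        + heightFrom 0 w (suc (2 ℕ.* k))          ≡⟨ ≡.sym (height≡heightFrom w r _) ⟩
        height w (suc (2 ℕ.* k))                  ≡⟨ ≡.cong (height w) (≡.sym (2[1+k]∸1≡1+2k k)) ⟩
        height w (2 ℕ.* suc k ∸ 1)                ∎))
    where open ℤ.≤-Reasoning

  sameBlock-atLevel : ∀ n w k′ k c′ → returnsToZero 0 w ≡ true → k′ ≤ k → c′ ≤ n →
    heightFrom 0 w (suc (2 ℕ.* k′)) ≡ suc (2 ℕ.* c′) → heightFrom 0 w (suc (2 ℕ.* k)) ≡ suc (2 ℕ.* c′) →
    (∀ x → suc (2 ℕ.* k′) ≤ x → x ≤ suc (2 ℕ.* k) → suc (2 ℕ.* c′) ≤ heightFrom 0 w x) →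
    sameBlock n w (suc k′) (suc k) ≡ true
  sameBlock-atLevel n w k′ k c′ r k′≤k c′≤n at-a at-b above =
    anyBelow-complete (suc (suc n)) (λ j → linked n w (2 ℕ.* suc k′ ∸ 1) (2 ℕ.* suc k ∸ 1) (+ (2 ℕ.* j) ℤ.- + 1))
      (suc c′) (s≤s (s≤s c′≤n))
      (linked-establish {n} {w}
        (≡.subst₂ _≤_ (≡.sym (2[1+k]∸1≡1+2k k′)) (≡.sym (2[1+k]∸1≡1+2k k)) (s≤s (ℕ.*-monoʳ-≤ 2 k′≤k)))
                        (height-at k′ at-a) (height-at k at-b)
                        (λ x a≤x x≤b → ≡.subst₂ ℤ._≤_ level (≡.sym (height≡heightFrom w r x))
                           (ℤ.+≤+ (above x (≡.subst (_≤ x) (2[1+k]∸1≡1+2k k′) a≤x)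
                                           (≡.subst (x ≤_) (2[1+k]∸1≡1+2k k) x≤b)))))
    where
    level : + suc (2 ℕ.* c′) ≡ + (2 ℕ.* suc c′) ℤ.- + 1
    level = ≡.cong (λ z → + z ℤ.- + 1) (≡.sym (ℕ.*-suc 2 c′))
    height-at : ∀ i → heightFrom 0 w (suc (2 ℕ.* i)) ≡ suc (2 ℕ.* c′) →
                height w (2 ℕ.* suc i ∸ 1) ≡ + (2 ℕ.* suc c′) ℤ.- + 1
    height-at i at-i = ≡.trans (height≡heightFrom w r _)
      (≡.trans (≡.cong (λ x → + heightFrom 0 w x) (2[1+k]∸1≡1+2k i)) (≡.trans (≡.cong +_ at-i) level))

  -- After the descent at 2k the path is at an odd level c; its last earlier visit to c is at an
  -- odd abscissa 2k′ + 1, and the path stays at level ≥ c in between.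
  blockLeader-down : ∀ n w k → returnsToZero 0 w ≡ true → length w ≡ 2 ℕ.* n → k < n →
                     stepAt w (2 ℕ.* k) ≡ false →
                     anyBelow k (λ k′ → sameBlock n w (suc k′) (suc k)) ≡ true
  blockLeader-down n w k r len k<n down =
    linkedTo (last-visit H c (heightFrom-suc-≤ 0 w) z≤n (2 ℕ.* k) (≡.subst (c <_) (≡.sym H2k≡1+c) (ℕ.n<1+n c)))
             (odd⇒1+2* c c-odd)
    where
    H : ℕ → ℕ
    H = heightFrom 0 w
    c : ℕ
    c = H (suc (2 ℕ.* k))
    1+2k≤len : suc (2 ℕ.* k) ≤ length w
    1+2k≤len = ≡.subst (suc (2 ℕ.* k) ≤_) (≡.sym len) (ℕ.*-monoʳ-< 2 k<n)
    H2k≡1+c : H (2 ℕ.* k) ≡ suc c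
    H2k≡1+c = heightFrom-down 0 w (2 ℕ.* k) r down 1+2k≤len
    c-odd : evenᵇ c ≡ false
    c-odd = ≡.trans (heightFrom-parity 0 w _ r 1+2k≤len) (≡.cong not (evenᵇ-2* k))
    linkedTo : (∃[ x₀ ] x₀ < 2 ℕ.* k × H x₀ ≡ c × (∀ x → x₀ ≤ x → x ≤ 2 ℕ.* k → c ≤ H x)) →
               ∃[ c′ ] c ≡ suc (2 ℕ.* c′) →
               anyBelow k (λ k′ → sameBlock n w (suc k′) (suc k)) ≡ true
    linkedTo (x₀ , x₀<2k , Hx₀≡c , above) (c′ , c≡1+2c′) with odd⇒1+2* x₀ x₀-odd
      where
      x₀-odd : evenᵇ x₀ ≡ false
      x₀-odd = ≡.trans
        (≡.sym (heightFrom-parity 0 w x₀ r (ℕ.≤-trans (ℕ.<⇒≤ x₀<2k) (ℕ.≤-trans (ℕ.n≤1+n _) 1+2k≤len))))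
        (≡.trans (≡.cong evenᵇ Hx₀≡c) c-odd)
    ... | k′ , ≡.refl = anyBelow-complete k _ k′ k′<k
      (sameBlock-atLevel n w k′ k c′ r (ℕ.<⇒≤ k′<k) c′≤n (≡.trans Hx₀≡c c≡1+2c′) c≡1+2c′
        (λ x a≤x x≤b → ≡.subst (_≤ H x) c≡1+2c′ (between x a≤x x≤b)))
      where
      k′<k : k′ < k
      k′<k = ℕ.*-cancelˡ-< 2 k′ k (ℕ.<-trans (ℕ.n<1+n _) x₀<2k)
      c′≤n : c′ ≤ n
      c′≤n = ℕ.≤-trans (ℕ.*-cancelˡ-≤ 2 (≤-pred (≡.subst (_≤ suc (2 ℕ.* k)) c≡1+2c′ (heightFrom-≤ 0 w _))))
                       (ℕ.<⇒≤ k<n)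
      between : ∀ x → suc (2 ℕ.* k′) ≤ x → x ≤ suc (2 ℕ.* k) → c ≤ H x
      between x a≤x x≤1+2k with m≤n⇒m<n∨m≡n x≤1+2k
      ... | inj₂ ≡.refl     = ≤-refl
      ... | inj₁ (s≤s x≤2k) = above x a≤x x≤2k

  blockLeader⇔up : ∀ n w k → returnsToZero 0 w ≡ true → length w ≡ 2 ℕ.* n → k < n →
                   not (anyBelow k (λ k′ → sameBlock n w (suc k′) (suc k))) ≡ stepAt w (2 ℕ.* k)
  blockLeader⇔up n w k r len k<n with stepAt w (2 ℕ.* k) in step
  ... | true  = ≡.cong not (blockLeader-up n w k r k<n step)
  ... | false = ≡.cong not (blockLeader-down n w k r len k<n step)

  upsAtEven upsAtOdd : List Bool → ℕ
  upsAtEven []      = 0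
  upsAtEven (b ∷ w) = (if b then 1 else 0) ℕ.+ upsAtOdd w
  upsAtOdd  []      = 0
  upsAtOdd  (b ∷ w) = upsAtEven w

  numUp≡upsAtEven+upsAtOdd : ∀ w → numUp w ≡ upsAtEven w ℕ.+ upsAtOdd w
  numUp≡upsAtEven+upsAtOdd []      = ≡.refl
  numUp≡upsAtEven+upsAtOdd (b ∷ w) = ≡.trans
    (≡.cong ((if b then 1 else 0) ℕ.+_)
            (≡.trans (numUp≡upsAtEven+upsAtOdd w) (ℕ.+-comm (upsAtEven w) (upsAtOdd w))))
    (≡.sym (ℕ.+-assoc (if b then 1 else 0) (upsAtOdd w) (upsAtEven w)))

  oddUps≡upsAtParity : ∀ h w → returnsToZero h w ≡ true →
                       oddUps h w ≡ (if evenᵇ h then upsAtOdd w else upsAtEven w)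
  oddUps≡upsAtParity zero    []          _ = ≡.refl
  oddUps≡upsAtParity h       (true ∷ w)  r =
    ≡.trans (≡.cong (tExp h ℕ.+_) (oddUps≡upsAtParity (suc h) w r)) (flip (evenᵇ h))
    where
    flip : ∀ e → (if not e then 1 else 0) ℕ.+ (if not e then upsAtOdd w else upsAtEven w) ≡
                 (if e then upsAtEven w else 1 ℕ.+ upsAtOdd w)
    flip true  = ≡.refl
    flip false = ≡.refl
  oddUps≡upsAtParity (suc h) (false ∷ w) r = ≡.trans (oddUps≡upsAtParity h w r) (flip (evenᵇ h))
    where
    flip : ∀ e → (if e then upsAtOdd w else upsAtEven w) ≡ (if not e then upsAtEven w else upsAtOdd w)
    flip true  = ≡.refl
    flip false = ≡.refl

  countBelow-stepAt-even : ∀ n w → length w ≡ 2 ℕ.* n → countBelow n (λ k → stepAt w (2 ℕ.* k)) ≡ upsAtEven w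
  countBelow-stepAt-even zero    []            _   = ≡.refl
  countBelow-stepAt-even (suc n) (b₁ ∷ b₂ ∷ w) len = ≡.trans (countBelow-suc n _)
    (≡.cong ((if b₁ then 1 else 0) ℕ.+_)
      (≡.trans (countBelow-cong n (λ k _ → ≡.cong (stepAt (b₁ ∷ b₂ ∷ w)) (ℕ.*-suc 2 k)))
               (countBelow-stepAt-even n w (ℕ.suc-injective (ℕ.suc-injective (≡.trans len (ℕ.*-suc 2 n)))))))
  countBelow-stepAt-even (suc n) []            len = contradiction (≡.trans len (ℕ.*-suc 2 n)) λ ()
  countBelow-stepAt-even (suc n) (_ ∷ [])      len = contradiction (≡.trans len (ℕ.*-suc 2 n)) λ ()

  rk≡oddUps : ∀ n w → returnsToZero 0 w ≡ true → length w ≡ 2 ℕ.* n → rk n w ≡ oddUps 0 w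
  rk≡oddUps n w r len = begin
    n ∸ numBlocks n w
      ≡⟨ ≡.cong (n ∸_) (countBelow-cong n (λ k k<n → blockLeader⇔up n w k r len k<n)) ⟩
    n ∸ countBelow n (λ k → stepAt w (2 ℕ.* k))
      ≡⟨ ≡.cong (n ∸_) (countBelow-stepAt-even n w len) ⟩
    n ∸ upsAtEven w
      ≡⟨ ≡.cong (_∸ upsAtEven w) (≡.trans (≡.sym (numUp≡half n w r len)) (numUp≡upsAtEven+upsAtOdd w)) ⟩
    upsAtEven w ℕ.+ upsAtOdd w ∸ upsAtEven w
      ≡⟨ ℕ.m+n∸m≡n (upsAtEven w) (upsAtOdd w) ⟩
    upsAtOdd w
      ≡⟨ ≡.sym (oddUps≡upsAtParity 0 w r) ⟩
    oddUps 0 w ∎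
    where open ≡.≡-Reasoning

open WeightedPaths using (returnsToZero; isWeightedPath; pathCount; countList-allWords-cong)
open DyckHeights using (isDyck≡returnsToZero; numUp≡half; staysBelow-complete)
open DyckArea using (area≡upArea)
open DyckRank using (rk≡oddUps)

dyckStatistics≡isWeightedPath : ∀ N n a b → n < N → ∀ w → length w ≡ 2 ℕ.* n →
  (isDyck n w ∧ ⌊ area n w ℕ.≟ a ⌋ ∧ ⌊ rk n w ℕ.≟ b ⌋) ≡ isWeightedPath N 0 a b w
dyckStatistics≡isWeightedPath N n a b n<N w len
  rewrite isDyck≡returnsToZero n w len with returnsToZero 0 w in r
... | false = ≡.refl
... | true rewrite area≡upArea n w r len | rk≡oddUps n w r len
                 | staysBelow-complete N 0 w r (≡.subst (_≤ N) (≡.sym (numUp≡half n w r len)) (ℕ.<⇒≤ n<N))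
                 = ≡.refl

proposition2p4 : ∀ (N n a b : ℕ) → n < N → Dgf n a b ≡ cf 1 N n a b
proposition2p4 N n a b n<N = begin
  Dgf n a b
    ≡⟨ ≡.cong +_ (countList-allWords-cong (2 ℕ.* n) (dyckStatistics≡isWeightedPath N n a b n<N)) ⟩
  + pathCount N 0 (2 ℕ.* n) a b
    ≡⟨ pathCount≡P (2 ℕ.* n) 0 n a b 2n≡n+n+0 z≤n ⟩
  P 1 n a b
    ≡⟨ Semiring.*-identityʳ Trivariate.semiring (E 0) n a b ⟩
  cf 1 N n a b ∎
  where
  open ≡.≡-Reasoning
  open PathTransfer N using (E; P; pathCount≡P)
  open import Data.Integer using (+_)
  2n≡n+n+0 : 2 ℕ.* n ≡ n ℕ.+ n ℕ.+ 0
  2n≡n+n+0 = ≡.trans (≡.cong (n ℕ.+_) (ℕ.+-identityʳ n)) (≡.sym (ℕ.+-identityʳ _))
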